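{- The canonical functor $P:\mathsf{PCyc}^{\mathrm{fin}}_{>0} \to \mathsf{Cyc}^{\mathrm{fin}}_{>0}$ exhibits $\mathsf{Cyc}^{\mathrm{fin}}_{>0}$ as the quotient of $\mathsf{PCyc}^{\mathrm{fin}}_{>0}$ by the $B\mathbb{Z}$-action: that is, for all $m,n\ge 1$ the induced map $\mathrm{Hom}((1/m)\mathbb{Z},(1/n)\mathbb{Z}) \to \mathrm{Hom}([m-1],[n-1])$ is surjective, and two morphisms have the same image if and only if they differ by the $\mathbb{Z}$-action (post-composition with a power of the shift $x\mapsto x+1$). Moreover this quotient is preserved by the nerve functor, i.e. the nerve of $\mathsf{Cyc}^{\mathrm{fin}}_{>0}$ is the quotient of the nerve of $\mathsf{PCyc}^{\mathrm{fin}}_{>0}$ by the induced $B\mathbb{Z}$-action.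
   Context: A cyclically ordered set is a set $S$ with a ternary relation $R$ satisfying: (Asymmetry) $R(x,y,z)\wedge R(x,z,w)\rightarrow y\neq w$; (Transitivity) $R(x,y,z)\wedge R(x,z,w)\rightarrow R(x,y,w)$; (Connectedness) for pairwise distinct $x,y,z$, $R(x,y,z)$ or $R(z,y,x)$; (Cyclicity) $R(x,y,z)\rightarrow R(y,z,x)$. Embeddings are injective maps preserving and reflecting $R$. $\mathsf{Cyc}^{\mathrm{fin}}_{>0}$ is the category of finite nonempty cyclically ordered sets and embeddings; $[n-1]$ denotes the cyclically ordered set with $n$ elements. A paracycle is the poset $(1/n)\mathbb{Z}$ ($n\ge1$) together with the automorphism $x\mapsto x+1$; $\mathsf{PCyc}^{\mathrm{fin}}_{>0}$ is the category of paracycles and order embeddings commuting with these automorphisms. $B\mathbb{Z}$ is the one-object category with morphism monoid $(\mathbb{Z},+)$, viewed as a strict categorical group; it acts on $\mathsf{PCyc}^{\mathrm{fin}}_{>0}$ by the $\mathbb{Z}$-action on hom-sets given by composing with powers of the shift $x\mapsto x+1$. The canonical functor $P$ sends $(1/n)\mathbb{Z}$ to the $n$-element cyclically ordered set $((1/n)\mathbb{Z})/\mathbb{Z}$ (with the cyclic order induced from the linear order on a fundamental domain $[a,a+1)$), and sends a morphism to the induced map on quotients by $\mathbb{Z}$. -}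

module Defs where

open import Data.Nat as ℕ using (ℕ; suc)
open import Data.Integer as ℤ using (ℤ; +_; _+_; _*_)
open import Data.Integer.DivMod using (_%ℕ_; n%ℕd<d)
open import Data.Fin as Fin using (Fin; toℕ; fromℕ<)
open import Data.List using (List; []; _∷_)
open import Data.Product using (Σ; ∃; _×_; _,_)
open import Data.Sum using (_⊎_)
open import Data.Unit using (⊤)
open import Relation.Binary.PropositionalEquality using (_≡_)

-- The paracycle (1/n)ℤ is presented in integer coordinates via the
-- order isomorphism x ↦ n·x : (1/n)ℤ ≅ ℤ.  Under it the automorphism
-- x ↦ x + 1 becomes a ↦ a + n.  So a morphism (1/m)ℤ → (1/n)ℤ
-- (order embedding commuting with the shifts) is a map ℤ → ℤ that
-- preserves and reflects ≤ and satisfies f (a + m) = f a + n.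

record PHom (m n : ℕ) : Set where
  field
    fun         : ℤ → ℤ
    preserves   : ∀ a b → a ℤ.≤ b → fun a ℤ.≤ fun b
    reflects    : ∀ a b → fun a ℤ.≤ fun b → a ℤ.≤ b
    equivariant : ∀ a → fun (a + + m) ≡ fun a + + n

open PHom public

-- The Z-action: f' = shift^k ∘ f for some k ∈ ℤ, where shift is
-- x ↦ x + 1 on (1/n)ℤ, i.e. a ↦ a + n in integer coordinates.
SameOrbit : ∀ {m n} → PHom m n → PHom m n → Set
SameOrbit {m} {n} f f' = ∃ λ (k : ℤ) → ∀ a → fun f' a ≡ fun f a + k * + n

CycR : ∀ {n} → Fin n → Fin n → Fin n → Set
CycR x y z = (x Fin.< y × y Fin.< z) ⊎ (y Fin.< z × z Fin.< x) ⊎ (z Fin.< x × x Fin.< y)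

record IsCycEmb {m n : ℕ} (g : Fin m → Fin n) : Set where
  field
    injective : ∀ i j → g i ≡ g j → i ≡ j
    preservesR : ∀ x y z → CycR x y z → CycR (g x) (g y) (g z)
    reflectsR  : ∀ x y z → CycR (g x) (g y) (g z) → CycR x y z

CHom : ℕ → ℕ → Set
CHom m n = Σ (Fin m → Fin n) IsCycEmb

cfun : ∀ {m n} → CHom m n → Fin m → Fin n
cfun (g , _) = g

-- The canonical functor P on morphisms.
-- ((1/m)ℤ)/ℤ is identified with Fin m via representatives in the
-- fundamental domain [0,1), i.e. integer coordinates 0,…,m-1; the
-- induced cyclic order is the standard one on Fin m.  P f sends the
-- class of i to the class of f(i), i.e. to f(i) mod n.

Pmap : ∀ {m n} → PHom m (suc n) → Fin m → Fin (suc n)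
Pmap {n = n} f i = fromℕ< (n%ℕd<d (fun f (+ toℕ i)) (suc n))

-- A k-simplex of the nerve of PCyc (resp. Cyc) starting at
-- object a with remaining objects bs (length k) is a chain of k
-- composable morphisms.  Objects are indexed so that index a stands for
-- (1/(suc a))ℤ, resp. [a] = Fin (suc a) (so all objects are nonempty).

PChain : ℕ → List ℕ → Set
PChain a []       = ⊤
PChain a (b ∷ bs) = PHom (suc a) (suc b) × PChain b bs

CChain : ℕ → List ℕ → Set
CChain a []       = ⊤
CChain a (b ∷ bs) = CHom (suc a) (suc b) × CChain b bs

-- N(P) applied to p equals c (componentwise P f = g).
LiesOver : ∀ a bs → PChain a bs → CChain a bs → Set
LiesOver a []       _        _        = ⊤
LiesOver a (b ∷ bs) (f , p)  (g , c)  = (∀ i → Pmap f i ≡ cfun g i) × LiesOver b bs p c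

-- N(P) p = N(P) p'.
SameImage : ∀ a bs → PChain a bs → PChain a bs → Set
SameImage a []       _        _         = ⊤
SameImage a (b ∷ bs) (f , p)  (f' , p') = (∀ i → Pmap f i ≡ Pmap f' i) × SameImage b bs p p'

-- The induced action of N(BZ)_k = ℤ^k on k-simplices: p' is in the
-- orbit of p iff each component differs by a power of the shift.
ChainOrbit : ∀ a bs → PChain a bs → PChain a bs → Set
ChainOrbit a []       _        _         = ⊤
ChainOrbit a (b ∷ bs) (f , p)  (f' , p') = SameOrbit f f' × ChainOrbit b bs p p'

-- In integer coordinates a morphism (1/m)ℤ → (1/n)ℤ is a strictly increasing
-- f : ℤ → ℤ with f (a + m) = f a + n, so it is determined by f 0 < ⋯ < f (m - 1),
-- which lie in the window [f 0, f 0 + n).  Reduction mod n maps an increasing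
-- triple inside a window of length n to a cyclically ordered triple and is
-- injective on the window: hence P f is an embedding, and two morphisms with
-- the same image differ on the window, hence everywhere, by one multiple k n.
-- Conversely a cyclic embedding g lifts into [g 0, g 0 + n) by adding n to the
-- values below g 0; cyclicity of g makes this lift increasing, and its periodic
-- extension is a morphism over g.  The statements about nerves follow levelwise.

module Submission where

open import Defs
open import Data.Nat using (ℕ; suc)
open import Data.List using (List)
open import Data.Product using (∃; _×_)
open import Function.Bundles using (_⇔_)
open import Relation.Binary.PropositionalEquality using (_≡_)

open import Data.Nat as ℕ using (zero; _%_)
import Data.Nat.Properties as ℕP
open import Data.Nat.DivMod using (m<n⇒m%n≡m; [m+n]%n≡m%n; m%n<n)
open import Data.Integer as ℤ using (ℤ; +_; -[1+_]; _+_; _-_; _*_; -_; ∣_∣; 0ℤ; 1ℤ)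
import Data.Integer.Properties as ℤP
open import Algebra.Properties.CommutativeSemigroup ℤP.+-commutativeSemigroup using (xy∙z≈xz∙y)
open import Data.Integer.DivMod using (_%ℕ_; _/ℕ_; n%ℕd<d; a≡a%ℕn+[a/ℕn]*n)
open import Data.Integer.Tactic.RingSolver using (solve)
open import Data.List using ([]; _∷_)
open import Data.Fin as Fin using (Fin; toℕ; fromℕ<)
import Data.Fin.Properties as FP
open import Data.Product using (_,_; proj₁; proj₂)
open import Data.Product.Function.NonDependent.Propositional using (_×-⇔_)
open import Data.Sum using (_⊎_; inj₁; inj₂)
open import Data.Empty using (⊥-elim)
open import Data.Unit using (tt)
open import Function using (_∘_)
open import Function.Bundles using (mk⇔)
open import Function.Construct.Identity using (⇔-id)
open import Relation.Nullary using (yes; no; ¬_)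
open import Relation.Binary using (tri<; tri≈; tri>; _Preserves_⟶_)
open import Relation.Binary.PropositionalEquality
  using (refl; sym; trans; cong; cong₂; subst; subst₂; _≢_; module ≡-Reasoning)

difference-of-decompositions : ∀ r q r′ q′ k → r + q * k ≡ r′ + q′ * k → (q - q′) * k ≡ r′ - r
difference-of-decompositions r q r′ q′ k e = begin
  (q - q′) * k                 ≡⟨ solve (r ∷ q ∷ q′ ∷ k ∷ []) ⟩
  (r + q * k) - (r + q′ * k)   ≡⟨ cong (_- (r + q′ * k)) e ⟩
  (r′ + q′ * k) - (r + q′ * k) ≡⟨ solve (r ∷ r′ ∷ q′ ∷ k ∷ []) ⟩
  r′ - r                       ∎
  where open ≡-Reasoning

module _ {n : ℕ} where
  private N = suc n

  ∣i*n∣<n⇒i≡0 : ∀ i → ∣ i * + N ∣ ℕ.< N → i ≡ 0ℤ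
  ∣i*n∣<n⇒i≡0 i lt = ℤP.∣i∣≡0⇒i≡0 (ℕP.n<1⇒n≡0 (ℕP.*-cancelʳ-< N ∣ i ∣ 1
    (subst₂ ℕ._<_ (ℤP.abs-* i (+ N)) (sym (ℕP.*-identityˡ N)) lt)))

  divMod-unique : ∀ {r q r′ q′} → r ℕ.< N → r′ ℕ.< N → + r + q * + N ≡ + r′ + q′ * + N → r ≡ r′ × q ≡ q′
  divMod-unique {r} {q} {r′} {q′} r<N r′<N e = r≡r′ , q≡q′
    where
      ∣r′-r∣<N : ∣ + r′ - + r ∣ ℕ.< N
      ∣r′-r∣<N = subst (ℕ._< N) (cong ∣_∣ (sym (ℤP.m-n≡m⊖n r′ r)))
        (ℕP.≤-<-trans (ℤP.∣m⊝n∣≤m⊔n r′ r) (ℕP.⊔-pres-<m r′<N r<N))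
      [q-q′]*N≡r′-r = difference-of-decompositions (+ r) q (+ r′) q′ (+ N) e
      q-q′≡0 : q - q′ ≡ 0ℤ
      q-q′≡0 = ∣i*n∣<n⇒i≡0 (q - q′) (subst (λ t → ∣ t ∣ ℕ.< N) (sym [q-q′]*N≡r′-r) ∣r′-r∣<N)
      q≡q′ : q ≡ q′
      q≡q′ = ℤP.i-j≡0⇒i≡j q q′ q-q′≡0
      r≡r′ : r ≡ r′
      r≡r′ = sym (ℤP.+-injective (ℤP.i-j≡0⇒i≡j (+ r′) (+ r)
        (trans (sym [q-q′]*N≡r′-r) (cong (_* + N) q-q′≡0))))

  %ℕ-/ℕ-unique : ∀ {a r q} → r ℕ.< N → a ≡ + r + q * + N → a %ℕ N ≡ r × a /ℕ N ≡ q
  %ℕ-/ℕ-unique {a} r<N a≡r+qN =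
    divMod-unique (n%ℕd<d a N) r<N (trans (sym (a≡a%ℕn+[a/ℕn]*n a N)) a≡r+qN)

  [i+j*n]%ℕn≡i%ℕn : ∀ i j → (i + j * + N) %ℕ N ≡ i %ℕ N
  [i+j*n]%ℕn≡i%ℕn i j = proj₁ (%ℕ-/ℕ-unique {q = i /ℕ N + j} (n%ℕd<d i N) (begin
    i + j * + N                              ≡⟨ cong (_+ j * + N) (a≡a%ℕn+[a/ℕn]*n i N) ⟩
    + (i %ℕ N) + (i /ℕ N) * + N + j * + N    ≡⟨ ℤP.+-assoc (+ (i %ℕ N)) ((i /ℕ N) * + N) (j * + N) ⟩
    + (i %ℕ N) + ((i /ℕ N) * + N + j * + N)  ≡⟨ cong (λ t → + (i %ℕ N) + t) (ℤP.*-distribʳ-+ (+ N) (i /ℕ N) j) ⟨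
    + (i %ℕ N) + (i /ℕ N + j) * + N          ∎))
    where open ≡-Reasoning

  %ℕ≡⇒differ-by-multiple : ∀ x y → x %ℕ N ≡ y %ℕ N → ∃ λ k → y ≡ x + k * + N
  %ℕ≡⇒differ-by-multiple x y e = k , (begin
    y                                      ≡⟨ a≡a%ℕn+[a/ℕn]*n y N ⟩
    + (y %ℕ N) + (y /ℕ N) * + N            ≡⟨ cong (λ r → + r + (y /ℕ N) * + N) (sym e) ⟩
    + (x %ℕ N) + (y /ℕ N) * + N            ≡⟨ regroup (+ (x %ℕ N)) (x /ℕ N) (y /ℕ N) (+ N) ⟩
    + (x %ℕ N) + (x /ℕ N) * + N + k * + N  ≡⟨ cong (_+ k * + N) (a≡a%ℕn+[a/ℕn]*n x N) ⟨
    x + k * + N                            ∎)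
    where
      open ≡-Reasoning
      k = y /ℕ N - x /ℕ N
      regroup : ∀ r q q′ k → r + q′ * k ≡ r + q * k + (q′ - q) * k
      regroup r q q′ k = solve (r ∷ q ∷ q′ ∷ k ∷ [])

  ∣c-x∣<n : ∀ {c x} → c ℤ.≤ x → x ℤ.< c + + N → ∣ c - x ∣ ℕ.< N
  ∣c-x∣<n {c} {x} c≤x x<c+N = ℤP.drop‿+<+ (begin-strict
    + ∣ c - x ∣   ≡⟨ ℤP.∣-∣-≤ c≤x ⟩
    x - c         <⟨ ℤP.+-monoˡ-< (ℤ.- c) x<c+N ⟩
    c + + N - c   ≡⟨ cancel c (+ N) ⟩
    + N           ∎)
    where
      open ℤP.≤-Reasoning
      cancel : ∀ i j → i + j - i ≡ j
      cancel i j = solve (i ∷ j ∷ [])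

  %ℕ-injective-on-window : ∀ {c x y} → c ℤ.≤ x → x ℤ.< c + + N → c ℤ.≤ y → y ℤ.< c + + N →
                           x %ℕ N ≡ y %ℕ N → x ≡ y
  %ℕ-injective-on-window {c} {x} {y} c≤x x<c+N c≤y y<c+N e with %ℕ≡⇒differ-by-multiple x y e
  ... | k , y≡x+kN = begin
    x              ≡⟨ ℤP.+-identityʳ x ⟨
    x + 0ℤ * + N   ≡⟨ cong (λ t → x + t * + N) k≡0 ⟨
    x + k * + N    ≡⟨ y≡x+kN ⟨
    y              ∎
    where
      open ≡-Reasoning
      offsets : + ∣ c - y ∣ + 0ℤ * + N ≡ + ∣ c - x ∣ + k * + N
      offsets = begin
        + ∣ c - y ∣ + 0ℤ * + N  ≡⟨ ℤP.+-identityʳ (+ ∣ c - y ∣) ⟩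
        + ∣ c - y ∣             ≡⟨ ℤP.∣-∣-≤ c≤y ⟩
        y - c                   ≡⟨ cong (_- c) y≡x+kN ⟩
        x + k * + N - c         ≡⟨ solve (x ∷ k ∷ c ∷ []) ⟩
        x - c + k * + N         ≡⟨ cong (_+ k * + N) (ℤP.∣-∣-≤ c≤x) ⟨
        + ∣ c - x ∣ + k * + N   ∎
      k≡0 : k ≡ 0ℤ
      k≡0 = sym (proj₂ (divMod-unique (∣c-x∣<n c≤y y<c+N) (∣c-x∣<n c≤x x<c+N) offsets))

  %ℕ-on-window : ∀ {c x} → c ℤ.≤ x → x %ℕ N ≡ (c %ℕ N ℕ.+ ∣ c - x ∣) % N
  %ℕ-on-window {c} {x} c≤x = begin
    x %ℕ N                                          ≡⟨ cong (_%ℕ N) x≡ρ+d+κN ⟩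
    (+ (c %ℕ N) + + ∣ c - x ∣ + (c /ℕ N) * + N) %ℕ N ≡⟨ [i+j*n]%ℕn≡i%ℕn (+ (c %ℕ N ℕ.+ ∣ c - x ∣)) (c /ℕ N) ⟩
    (c %ℕ N ℕ.+ ∣ c - x ∣) % N                      ∎
    where
      open ≡-Reasoning
      x≡ρ+d+κN : x ≡ + (c %ℕ N) + + ∣ c - x ∣ + (c /ℕ N) * + N
      x≡ρ+d+κN = begin
        x                                            ≡⟨ solve (x ∷ c ∷ []) ⟩
        c + (x - c)                                  ≡⟨ cong₂ _+_ (a≡a%ℕn+[a/ℕn]*n c N) (sym (ℤP.∣-∣-≤ c≤x)) ⟩
        + (c %ℕ N) + (c /ℕ N) * + N + + ∣ c - x ∣    ≡⟨ xy∙z≈xz∙y (+ (c %ℕ N)) ((c /ℕ N) * + N) (+ ∣ c - x ∣) ⟩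
        + (c %ℕ N) + + ∣ c - x ∣ + (c /ℕ N) * + N    ∎

-- CycR x y z unfolds to CycRℕ (toℕ x) (toℕ y) (toℕ z).
CycRℕ : ℕ → ℕ → ℕ → Set
CycRℕ a b c = (a ℕ.< b × b ℕ.< c) ⊎ (b ℕ.< c × c ℕ.< a) ⊎ (c ℕ.< a × a ℕ.< b)

CycRℕ-rotate : ∀ {a b c} → CycRℕ a b c → CycRℕ b c a
CycRℕ-rotate (inj₁ p)        = inj₂ (inj₂ p)
CycRℕ-rotate (inj₂ (inj₁ p)) = inj₁ p
CycRℕ-rotate (inj₂ (inj₂ p)) = inj₂ (inj₁ p)

CycRℕ-asym : ∀ {a b c} → CycRℕ a b c → ¬ CycRℕ c b a
CycRℕ-asym (inj₁ (a<b , b<c)) (inj₁ (c<b , _))        = ℕP.<-asym b<c c<b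
CycRℕ-asym (inj₁ (a<b , b<c)) (inj₂ (inj₁ (b<a , _))) = ℕP.<-asym a<b b<a
CycRℕ-asym (inj₁ (a<b , b<c)) (inj₂ (inj₂ (_ , c<b))) = ℕP.<-asym b<c c<b
CycRℕ-asym (inj₂ (inj₁ p)) q = CycRℕ-asym (inj₁ p) (CycRℕ-rotate (CycRℕ-rotate q))
CycRℕ-asym (inj₂ (inj₂ p)) q = CycRℕ-asym (inj₁ p) (CycRℕ-rotate q)

CycRℕ-distinct : ∀ {a b c} → CycRℕ a b c → a ≢ b × b ≢ c × a ≢ c
CycRℕ-distinct r =
  (λ { refl → CycRℕ-asym r (CycRℕ-rotate (CycRℕ-rotate r)) }) ,
  (λ { refl → CycRℕ-asym r (CycRℕ-rotate r) }) ,
  (λ { refl → CycRℕ-asym r r })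

CycRℕ-connected : ∀ {a b c} → a ≢ b → b ≢ c → a ≢ c → CycRℕ a b c ⊎ CycRℕ c b a
CycRℕ-connected {a} {b} {c} a≢b b≢c a≢c with ℕP.<-cmp a b | ℕP.<-cmp b c | ℕP.<-cmp a c
... | tri≈ _ a≡b _ | _            | _            = ⊥-elim (a≢b a≡b)
... | _            | tri≈ _ b≡c _ | _            = ⊥-elim (b≢c b≡c)
... | _            | _            | tri≈ _ a≡c _ = ⊥-elim (a≢c a≡c)
... | tri< a<b _ _ | tri< b<c _ _ | _            = inj₁ (inj₁ (a<b , b<c))
... | tri< a<b _ _ | tri> _ _ c<b | tri< a<c _ _ = inj₂ (inj₂ (inj₂ (a<c , c<b)))
... | tri< a<b _ _ | tri> _ _ c<b | tri> _ _ c<a = inj₁ (inj₂ (inj₂ (c<a , a<b)))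
... | tri> _ _ b<a | tri< b<c _ _ | tri< a<c _ _ = inj₂ (inj₂ (inj₁ (b<a , a<c)))
... | tri> _ _ b<a | tri< b<c _ _ | tri> _ _ c<a = inj₁ (inj₂ (inj₁ (b<c , c<a)))
... | tri> _ _ b<a | tri> _ _ c<b | _            = inj₂ (inj₁ (c<b , b<a))

CycRℕ-resp : ∀ {a b c a′ b′ c′} → a ≡ a′ → b ≡ b′ → c ≡ c′ → CycRℕ a b c → CycRℕ a′ b′ c′
CycRℕ-resp refl refl refl r = r

preservesR⇒reflectsR : ∀ {m n} (g : Fin m → Fin n) → (∀ x y z → CycR x y z → CycR (g x) (g y) (g z)) →
                       ∀ x y z → CycR (g x) (g y) (g z) → CycR x y z
preservesR⇒reflectsR g preservesR x y z r
  with CycRℕ-distinct r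
... | gx≢gy , gy≢gz , gx≢gz
  with CycRℕ-connected (gx≢gy ∘ g-cong) (gy≢gz ∘ g-cong) (gx≢gz ∘ g-cong)
  where
    g-cong : ∀ {i j} → toℕ i ≡ toℕ j → toℕ (g i) ≡ toℕ (g j)
    g-cong = cong (toℕ ∘ g) ∘ FP.toℕ-injective
... | inj₁ xyz = xyz
... | inj₂ zyx = ⊥-elim (CycRℕ-asym r (preservesR z y x zyx))

module _ {n : ℕ} where
  private N = suc n

  [ρ+d]%n-wrap : ∀ {ρ d} → ρ ℕ.< N → d ℕ.< N → (ρ ℕ.+ d) % N ≡ ρ ℕ.+ d ⊎ (ρ ℕ.+ d) % N ℕ.+ N ≡ ρ ℕ.+ d
  [ρ+d]%n-wrap {ρ} {d} ρ<N d<N with ρ ℕ.+ d ℕ.<? N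
  ... | yes ρ+d<N = inj₁ (m<n⇒m%n≡m ρ+d<N)
  ... | no ρ+d≮N = inj₂ (begin
    x % N ℕ.+ N             ≡⟨ cong (λ t → t % N ℕ.+ N) (ℕP.m∸n+n≡m N≤x) ⟨
    (x∸N ℕ.+ N) % N ℕ.+ N   ≡⟨ cong (ℕ._+ N) ([m+n]%n≡m%n x∸N N) ⟩
    x∸N % N ℕ.+ N           ≡⟨ cong (ℕ._+ N) (m<n⇒m%n≡m x∸N<N) ⟩
    x∸N ℕ.+ N               ≡⟨ ℕP.m∸n+n≡m N≤x ⟩
    x                       ∎)
    where
      open ≡-Reasoning
      x = ρ ℕ.+ d
      x∸N = x ℕ.∸ N
      N≤x = ℕP.≮⇒≥ ρ+d≮N
      x∸N<N : x∸N ℕ.< N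
      x∸N<N = ℕP.+-cancelʳ-< N x∸N N (subst (ℕ._< N ℕ.+ N) (sym (ℕP.m∸n+n≡m N≤x)) (ℕP.+-mono-< ρ<N d<N))

  private
    module _ {ρ : ℕ} where
      wrapped<ρ : ∀ {d} → (ρ ℕ.+ d) % N ℕ.+ N ≡ ρ ℕ.+ d → d ℕ.< N → (ρ ℕ.+ d) % N ℕ.< ρ
      wrapped<ρ {d} w d<N = ℕP.+-cancelʳ-< N ((ρ ℕ.+ d) % N) ρ
        (subst (ℕ._< ρ ℕ.+ N) (sym w) (ℕP.+-monoʳ-< ρ d<N))

      wrapped-mono : ∀ {d d′} → (ρ ℕ.+ d) % N ℕ.+ N ≡ ρ ℕ.+ d → (ρ ℕ.+ d′) % N ℕ.+ N ≡ ρ ℕ.+ d′ →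
                     d ℕ.< d′ → (ρ ℕ.+ d) % N ℕ.< (ρ ℕ.+ d′) % N
      wrapped-mono w w′ d<d′ = ℕP.+-cancelʳ-< N _ _ (subst₂ ℕ._<_ (sym w) (sym w′) (ℕP.+-monoʳ-< ρ d<d′))

      wrapped-before-unwrapped : ∀ {d d′} → (ρ ℕ.+ d) % N ℕ.+ N ≡ ρ ℕ.+ d → (ρ ℕ.+ d′) % N ≡ ρ ℕ.+ d′ →
                                 ¬ d ℕ.< d′
      wrapped-before-unwrapped {d} {d′} w e d<d′ = ℕP.<-irrefl refl (begin-strict
        N                   ≤⟨ ℕP.m≤n+m N _ ⟩
        (ρ ℕ.+ d) % N ℕ.+ N ≡⟨ w ⟩
        ρ ℕ.+ d             <⟨ ℕP.+-monoʳ-< ρ d<d′ ⟩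
        ρ ℕ.+ d′            ≡⟨ e ⟨
        (ρ ℕ.+ d′) % N      <⟨ m%n<n (ρ ℕ.+ d′) N ⟩
        N                   ∎)
        where open ℕP.≤-Reasoning

  -- Adding ρ makes exactly the largest offsets wrap around past N.
  rotate-CycRℕ : ∀ {ρ d₁ d₂ d₃} → ρ ℕ.< N → d₁ ℕ.< d₂ → d₂ ℕ.< d₃ → d₃ ℕ.< N →
                 CycRℕ ((ρ ℕ.+ d₁) % N) ((ρ ℕ.+ d₂) % N) ((ρ ℕ.+ d₃) % N)
  rotate-CycRℕ {ρ} {d₁} {d₂} {d₃} ρ<N d₁<d₂ d₂<d₃ d₃<N
    with [ρ+d]%n-wrap ρ<N (ℕP.<-trans d₁<d₂ d₂<N) | [ρ+d]%n-wrap ρ<N d₂<N | [ρ+d]%n-wrap ρ<N d₃<N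
    where d₂<N = ℕP.<-trans d₂<d₃ d₃<N
  ... | inj₁ e₁ | inj₁ e₂ | inj₁ e₃ = CycRℕ-resp (sym e₁) (sym e₂) (sym e₃)
    (inj₁ (ℕP.+-monoʳ-< ρ d₁<d₂ , ℕP.+-monoʳ-< ρ d₂<d₃))
  ... | inj₁ e₁ | inj₁ e₂ | inj₂ w₃ = CycRℕ-resp (sym e₁) (sym e₂) refl
    (inj₂ (inj₂ (ℕP.<-≤-trans (wrapped<ρ w₃ d₃<N) (ℕP.m≤m+n ρ d₁) , ℕP.+-monoʳ-< ρ d₁<d₂)))
  ... | inj₁ e₁ | inj₂ w₂ | inj₂ w₃ = CycRℕ-resp (sym e₁) refl refl
    (inj₂ (inj₁ (wrapped-mono w₂ w₃ d₂<d₃ , ℕP.<-≤-trans (wrapped<ρ w₃ d₃<N) (ℕP.m≤m+n ρ d₁))))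
  ... | inj₂ w₁ | inj₂ w₂ | inj₂ w₃ = inj₁ (wrapped-mono w₁ w₂ d₁<d₂ , wrapped-mono w₂ w₃ d₂<d₃)
  ... | inj₂ w₁ | inj₁ e₂ | _       = ⊥-elim (wrapped-before-unwrapped w₁ e₂ d₁<d₂)
  ... | _       | inj₂ w₂ | inj₁ e₃ = ⊥-elim (wrapped-before-unwrapped w₂ e₃ d₂<d₃)

-- Pmap f i is reduce (fun f (+ toℕ i)) by definition.
reduce : ∀ {n} → ℤ → Fin (suc n)
reduce {n} x = fromℕ< (n%ℕd<d x (suc n))

module _ {n : ℕ} where
  private N = suc n

  toℕ-reduce : ∀ x → toℕ (reduce {n} x) ≡ x %ℕ N
  toℕ-reduce x = FP.toℕ-fromℕ< (n%ℕd<d x N)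

  reduce-toℕ : ∀ j → reduce {n} (+ toℕ j) ≡ j
  reduce-toℕ j = FP.toℕ-injective (trans (toℕ-reduce (+ toℕ j)) (m<n⇒m%n≡m (FP.toℕ<n j)))

  reduce-+-* : ∀ x k → reduce {n} (x + k * + N) ≡ reduce x
  reduce-+-* x k = FP.toℕ-injective (begin
    toℕ (reduce (x + k * + N))  ≡⟨ toℕ-reduce (x + k * + N) ⟩
    (x + k * + N) %ℕ N          ≡⟨ [i+j*n]%ℕn≡i%ℕn x k ⟩
    x %ℕ N                      ≡⟨ toℕ-reduce x ⟨
    toℕ (reduce x)              ∎)
    where open ≡-Reasoning

  reduce≡⇒%ℕ≡ : ∀ x y → reduce {n} x ≡ reduce y → x %ℕ N ≡ y %ℕ N
  reduce≡⇒%ℕ≡ x y e = trans (sym (toℕ-reduce x)) (trans (cong toℕ e) (toℕ-reduce y))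

  reduce-decomposition : ∀ x → x ≡ + toℕ (reduce {n} x) + (x /ℕ N) * + N
  reduce-decomposition x = trans (a≡a%ℕn+[a/ℕn]*n x N) (cong (λ r → + r + (x /ℕ N) * + N) (sym (toℕ-reduce x)))

  reduce-injective-on-window : ∀ {c x y} → c ℤ.≤ x → x ℤ.< c + + N → c ℤ.≤ y → y ℤ.< c + + N →
                               reduce {n} x ≡ reduce y → x ≡ y
  reduce-injective-on-window {x = x} {y} c≤x x<c+N c≤y y<c+N =
    %ℕ-injective-on-window c≤x x<c+N c≤y y<c+N ∘ reduce≡⇒%ℕ≡ x y

  reduce-CycR-on-window : ∀ {c x y z} → c ℤ.≤ x → x ℤ.< y → y ℤ.< z → z ℤ.< c + + N →
                          CycR (reduce {n} x) (reduce y) (reduce z)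
  reduce-CycR-on-window {c} {x} {y} {z} c≤x x<y y<z z<c+N =
    CycRℕ-resp (toℕ-reduce-on-window c≤x) (toℕ-reduce-on-window c≤y) (toℕ-reduce-on-window c≤z)
      (rotate-CycRℕ (n%ℕd<d c N) (offset-mono c≤x x<y) (offset-mono c≤y y<z) (∣c-x∣<n c≤z z<c+N))
    where
      c≤y = ℤP.≤-trans c≤x (ℤP.<⇒≤ x<y)
      c≤z = ℤP.≤-trans c≤y (ℤP.<⇒≤ y<z)
      toℕ-reduce-on-window : ∀ {w} → c ℤ.≤ w → (c %ℕ N ℕ.+ ∣ c - w ∣) % N ≡ toℕ (reduce {n} w)
      toℕ-reduce-on-window {w} c≤w = sym (trans (toℕ-reduce w) (%ℕ-on-window c≤w))
      offset-mono : ∀ {v w} → c ℤ.≤ v → v ℤ.< w → ∣ c - v ∣ ℕ.< ∣ c - w ∣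
      offset-mono {v} {w} c≤v v<w = ℤP.drop‿+<+ (subst₂ ℤ._<_ (sym (ℤP.∣-∣-≤ c≤v))
        (sym (ℤP.∣-∣-≤ (ℤP.≤-trans c≤v (ℤP.<⇒≤ v<w)))) (ℤP.+-monoˡ-< (ℤ.- c) v<w))

module _ {m n : ℕ} (u : Fin m → ℤ) (u-strict : u Preserves Fin._<_ ⟶ ℤ._<_) (c : ℤ)
         (u-window : ∀ i → c ℤ.≤ u i × u i ℤ.< c + + suc n) where

  reduce∘window-IsCycEmb : IsCycEmb (reduce {n} ∘ u)
  reduce∘window-IsCycEmb = record
    { injective  = injective
    ; preservesR = preservesR
    ; reflectsR  = preservesR⇒reflectsR (reduce ∘ u) preservesR
    }
    where
      u-injective : ∀ {i j} → u i ≡ u j → i ≡ j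
      u-injective {i} {j} ui≡uj with FP.<-cmp i j
      ... | tri< i<j _ _ = ⊥-elim (ℤP.<-irrefl ui≡uj (u-strict i<j))
      ... | tri≈ _ i≡j _ = i≡j
      ... | tri> _ _ j<i = ⊥-elim (ℤP.<-irrefl (sym ui≡uj) (u-strict j<i))

      injective : ∀ i j → reduce {n} (u i) ≡ reduce (u j) → i ≡ j
      injective i j = u-injective ∘ reduce-injective-on-window (proj₁ (u-window i)) (proj₂ (u-window i))
                                                               (proj₁ (u-window j)) (proj₂ (u-window j))

      increasing : ∀ {i j k} → i Fin.< j → j Fin.< k → CycR (reduce {n} (u i)) (reduce (u j)) (reduce (u k))
      increasing {i} {k = k} i<j j<k =
        reduce-CycR-on-window (proj₁ (u-window i)) (u-strict i<j) (u-strict j<k) (proj₂ (u-window k))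

      preservesR : ∀ x y z → CycR x y z → CycR (reduce {n} (u x)) (reduce (u y)) (reduce (u z))
      preservesR x y z (inj₁ (x<y , y<z))        = increasing x<y y<z
      preservesR x y z (inj₂ (inj₁ (y<z , z<x))) = CycRℕ-rotate (CycRℕ-rotate (increasing y<z z<x))
      preservesR x y z (inj₂ (inj₂ (z<x , x<y))) = CycRℕ-rotate (increasing z<x x<y)

module _ {m n : ℕ} (f : PHom m n) where

  fun-strictMono : fun f Preserves ℤ._<_ ⟶ ℤ._<_
  fun-strictMono {a} {b} a<b = ℤP.≰⇒> (ℤP.<⇒≱ a<b ∘ reflects f b a)

  fun-+-ℕ* : ∀ a k → fun f (a + + k * + m) ≡ fun f a + + k * + n
  fun-+-ℕ* a zero    = trans (cong (fun f) (ℤP.+-identityʳ a)) (sym (ℤP.+-identityʳ (fun f a)))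
  fun-+-ℕ* a (suc k) = begin
    fun f (a + + suc k * + m)    ≡⟨ cong (fun f) (shift a (+ k) (+ m)) ⟩
    fun f (a + + k * + m + + m)  ≡⟨ equivariant f (a + + k * + m) ⟩
    fun f (a + + k * + m) + + n  ≡⟨ cong (_+ + n) (fun-+-ℕ* a k) ⟩
    fun f a + + k * + n + + n    ≡⟨ shift (fun f a) (+ k) (+ n) ⟨
    fun f a + + suc k * + n      ∎
    where
      open ≡-Reasoning
      shift : ∀ x t d → x + (+ 1 + t) * d ≡ x + t * d + d
      shift x t d = solve (x ∷ t ∷ d ∷ [])

  fun-+-* : ∀ a q → fun f (a + q * + m) ≡ fun f a + q * + n
  fun-+-* a (+ k)    = fun-+-ℕ* a k
  fun-+-* a -[1+ k ] = begin
    fun f b                               ≡⟨ add-sub (fun f b) t (+ n) ⟩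
    fun f b + t * + n + - t * + n         ≡⟨ cong (_+ - t * + n) (fun-+-ℕ* b (suc k)) ⟨
    fun f (b + t * + m) + - t * + n       ≡⟨ cong (λ x → fun f x + - t * + n) (sub-add a t (+ m)) ⟨
    fun f a + - t * + n                   ∎
    where
      open ≡-Reasoning
      t = + suc k
      b = a + - t * + m
      add-sub : ∀ x t d → x ≡ x + t * d + - t * d
      add-sub x t d = solve (x ∷ t ∷ d ∷ [])
      sub-add : ∀ x t d → x ≡ x + - t * d + t * d
      sub-add x t d = solve (x ∷ t ∷ d ∷ [])

  fun-window : ∀ i → i ℕ.< m → fun f (+ 0) ℤ.≤ fun f (+ i) × fun f (+ i) ℤ.< fun f (+ 0) + + n
  fun-window i i<m = preserves f (+ 0) (+ i) (ℤ.+≤+ ℕ.z≤n) ,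
                     subst (fun f (+ i) ℤ.<_) (equivariant f (+ 0)) (fun-strictMono (ℤ.+<+ i<m))

Pmap-IsCycEmb : ∀ {m n} (f : PHom m (suc n)) → IsCycEmb (Pmap f)
Pmap-IsCycEmb f = reduce∘window-IsCycEmb (λ i → fun f (+ toℕ i)) (fun-strictMono f ∘ ℤ.+<+) (fun f (+ 0))
  (λ i → fun-window f (toℕ i) (FP.toℕ<n i))

module _ {m n : ℕ} (f f′ : PHom (suc m) (suc n)) where
  private
    M = suc m
    N = suc n

  fundamentalDomain⇒SameOrbit : ∀ k → (∀ i → fun f′ (+ toℕ i) ≡ fun f (+ toℕ i) + k * + N) → SameOrbit f f′
  fundamentalDomain⇒SameOrbit k on-domain = k , shifted
    where
      shifted : ∀ a → fun f′ a ≡ fun f a + k * + N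
      shifted a = begin
        fun f′ a                              ≡⟨ cong (fun f′) (reduce-decomposition a) ⟩
        fun f′ (+ toℕ r + q * + M)            ≡⟨ fun-+-* f′ (+ toℕ r) q ⟩
        fun f′ (+ toℕ r) + q * + N            ≡⟨ cong (_+ q * + N) (on-domain r) ⟩
        fun f (+ toℕ r) + k * + N + q * + N   ≡⟨ xy∙z≈xz∙y (fun f (+ toℕ r)) (k * + N) (q * + N) ⟩
        fun f (+ toℕ r) + q * + N + k * + N   ≡⟨ cong (_+ k * + N) (fun-+-* f (+ toℕ r) q) ⟨
        fun f (+ toℕ r + q * + M) + k * + N   ≡⟨ cong (λ x → fun f x + k * + N) (reduce-decomposition a) ⟨
        fun f a + k * + N                     ∎
        where
          open ≡-Reasoning
          r = reduce {m} a
          q = a /ℕ M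

  samePmap⇒SameOrbit : (∀ i → Pmap f i ≡ Pmap f′ i) → SameOrbit f f′
  samePmap⇒SameOrbit same with %ℕ≡⇒differ-by-multiple c c′ (reduce≡⇒%ℕ≡ c c′ (same Fin.zero))
    where
      c = fun f (+ 0)
      c′ = fun f′ (+ 0)
  ... | k , c′≡c+kN = fundamentalDomain⇒SameOrbit k on-domain
    where
      on-domain : ∀ i → fun f′ (+ toℕ i) ≡ fun f (+ toℕ i) + k * + N
      on-domain i = sym (reduce-injective-on-window lower upper (proj₁ W′) (proj₂ W′)
                           (trans (reduce-+-* (fun f (+ toℕ i)) k) (same i)))
        where
          W = fun-window f (toℕ i) (FP.toℕ<n i)
          W′ = fun-window f′ (toℕ i) (FP.toℕ<n i)
          x = fun f (+ toℕ i) + k * + N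
          lower : fun f′ (+ 0) ℤ.≤ x
          lower = subst (ℤ._≤ x) (sym c′≡c+kN) (ℤP.+-monoˡ-≤ (k * + N) (proj₁ W))
          upper : x ℤ.< fun f′ (+ 0) + + N
          upper = subst (x ℤ.<_) (trans (xy∙z≈xz∙y (fun f (+ 0)) (+ N) (k * + N)) (cong (_+ + N) (sym c′≡c+kN)))
                    (ℤP.+-monoˡ-< (k * + N) (proj₂ W))

  SameOrbit⇒samePmap : SameOrbit f f′ → ∀ i → Pmap f i ≡ Pmap f′ i
  SameOrbit⇒samePmap (k , f′≡f+kN) i =
    sym (trans (cong reduce (f′≡f+kN (+ toℕ i))) (reduce-+-* (fun f (+ toℕ i)) k))

  Pmap-fibres : (∀ i → Pmap f i ≡ Pmap f′ i) ⇔ SameOrbit f f′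
  Pmap-fibres = mk⇔ samePmap⇒SameOrbit SameOrbit⇒samePmap

successor-increasing⇒strictMono : ∀ (F : ℤ → ℤ) → (∀ a → F a ℤ.< F (a + 1ℤ)) → F Preserves ℤ._<_ ⟶ ℤ._<_
successor-increasing⇒strictMono F step {a} {b} a<b with ∣ a - b ∣ | ℤP.∣-∣-≤ (ℤP.<⇒≤ a<b)
... | zero  | 0≡b-a   = ⊥-elim (ℤP.<-irrefl (sym (ℤP.i-j≡0⇒i≡j b a (sym 0≡b-a))) a<b)
... | suc k | 1+k≡b-a = subst (λ x → F a ℤ.< F x) b≡a+1+k (F-a<F-a+1+ a k)
  where
    b≡a+1+k : a + + suc k ≡ b
    b≡a+1+k = trans (cong (λ t → a + t) 1+k≡b-a) (solve (a ∷ b ∷ []))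
    F-a<F-a+1+ : ∀ a k → F a ℤ.< F (a + + suc k)
    F-a<F-a+1+ a zero    = step a
    F-a<F-a+1+ a (suc k) = ℤP.<-trans (step a)
      (subst (λ x → F (a + 1ℤ) ℤ.< F x) (ℤP.+-assoc a 1ℤ (+ suc k)) (F-a<F-a+1+ (a + 1ℤ) k))

mkPHom : ∀ {m n} (F : ℤ → ℤ) → F Preserves ℤ._<_ ⟶ ℤ._<_ → (∀ a → F (a + + m) ≡ F a + + n) → PHom m n
mkPHom F F-strict F-equivariant = record
  { fun         = F
  ; preserves   = F-preserves
  ; reflects    = F-reflects
  ; equivariant = F-equivariant
  }
  where
    F-preserves : ∀ a b → a ℤ.≤ b → F a ℤ.≤ F b
    F-preserves a b a≤b with a ℤ.≟ b
    ... | yes refl = ℤP.≤-refl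
    ... | no  a≢b  = ℤP.<⇒≤ (F-strict (ℤP.≤∧≢⇒< a≤b a≢b))
    F-reflects : ∀ a b → F a ℤ.≤ F b → a ℤ.≤ b
    F-reflects a b Fa≤Fb with a ℤ.≤? b
    ... | yes a≤b = a≤b
    ... | no  a≰b = ⊥-elim (ℤP.<⇒≱ (F-strict (ℤP.≰⇒> a≰b)) Fa≤Fb)

module PeriodicExtension {m n : ℕ} (ℓ : Fin (suc m) → ℤ) (ℓ-strict : ℓ Preserves Fin._<_ ⟶ ℤ._<_)
                         (ℓ<ℓ₀+n : ∀ i → ℓ i ℤ.< ℓ Fin.zero + + suc n) where
  private
    M = suc m
    N = suc n

  extend : ℤ → ℤ
  extend a = ℓ (reduce a) + (a /ℕ M) * + N

  extend-+-* : ∀ i q → extend (+ toℕ i + q * + M) ≡ ℓ i + q * + N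
  extend-+-* i q = cong₂ (λ j p → ℓ j + p * + N)
    (FP.toℕ-injective (trans (toℕ-reduce (+ toℕ i + q * + M)) (proj₁ unique))) (proj₂ unique)
    where unique = %ℕ-/ℕ-unique {q = q} (FP.toℕ<n i) refl

  extend-equivariant : ∀ a → extend (a + + M) ≡ extend a + + N
  extend-equivariant a = begin
    extend (a + + M)                    ≡⟨ cong extend a+M≡r+[q+1]M ⟩
    extend (+ toℕ r + (q + 1ℤ) * + M)   ≡⟨ extend-+-* r (q + 1ℤ) ⟩
    ℓ r + (q + 1ℤ) * + N                ≡⟨ shift (ℓ r) q (+ N) ⟨
    ℓ r + q * + N + + N                 ∎
    where
      open ≡-Reasoning
      r = reduce {m} a
      q = a /ℕ M
      shift : ∀ x q d → x + q * d + d ≡ x + (q + 1ℤ) * d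
      shift x q d = solve (x ∷ q ∷ d ∷ [])
      a+M≡r+[q+1]M : a + + M ≡ + toℕ r + (q + 1ℤ) * + M
      a+M≡r+[q+1]M = trans (cong (_+ + M) (reduce-decomposition a)) (shift (+ toℕ r) q (+ M))

  extend-suc : ∀ r q → ℓ r + q * + N ℤ.< extend (+ toℕ r + q * + M + 1ℤ)
  extend-suc r q with suc (toℕ r) ℕ.<? M
  ... | yes 1+r<M = subst (ℓ r + q * + N ℤ.<_) (sym (trans (cong extend next) (extend-+-* r′ q)))
                      (ℤP.+-monoˡ-< (q * + N) (ℓ-strict r<r′))
    where
      r′ = fromℕ< 1+r<M
      r<r′ : r Fin.< r′
      r<r′ = subst (toℕ r ℕ.<_) (sym (FP.toℕ-fromℕ< 1+r<M)) (ℕP.n<1+n (toℕ r))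
      regroup : ∀ x y → x + y + 1ℤ ≡ 1ℤ + x + y
      regroup x y = solve (x ∷ y ∷ [])
      next : + toℕ r + q * + M + 1ℤ ≡ + toℕ r′ + q * + M
      next = trans (regroup (+ toℕ r) (q * + M)) (cong (λ t → + t + q * + M) (sym (FP.toℕ-fromℕ< 1+r<M)))
  ... | no 1+r≮M = subst (ℓ r + q * + N ℤ.<_) (sym value) (ℤP.+-monoˡ-< (q * + N) (ℓ<ℓ₀+n r))
    where
      r≡m : toℕ r ≡ m
      r≡m = ℕP.≤-antisym (ℕ.s≤s⁻¹ (FP.toℕ<n r)) (ℕ.s≤s⁻¹ (ℕP.≮⇒≥ 1+r≮M))
      carry : ∀ t q → t + q * (1ℤ + t) + 1ℤ ≡ 0ℤ + (q + 1ℤ) * (1ℤ + t)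
      carry t q = solve (t ∷ q ∷ [])
      regroup : ∀ x q d → x + (q + 1ℤ) * d ≡ x + d + q * d
      regroup x q d = solve (x ∷ q ∷ d ∷ [])
      wrap : + toℕ r + q * + M + 1ℤ ≡ + toℕ (Fin.zero {m}) + (q + 1ℤ) * + M
      wrap = trans (cong (λ t → + t + q * + M + 1ℤ) r≡m) (carry (+ m) q)
      value : extend (+ toℕ r + q * + M + 1ℤ) ≡ ℓ Fin.zero + + N + q * + N
      value = trans (cong extend wrap) (trans (extend-+-* Fin.zero (q + 1ℤ)) (regroup (ℓ Fin.zero) q (+ N)))

  extend-step : ∀ a → extend a ℤ.< extend (a + 1ℤ)
  extend-step a = subst (λ x → extend a ℤ.< extend (x + 1ℤ)) (sym (reduce-decomposition a))
                        (extend-suc (reduce a) (a /ℕ M))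

  extension : PHom M N
  extension = mkPHom extend (successor-increasing⇒strictMono extend extend-step) extend-equivariant

  extension-on-domain : ∀ i → fun extension (+ toℕ i) ≡ ℓ i
  extension-on-domain i = begin
    extend (+ toℕ i)              ≡⟨ cong extend (ℤP.+-identityʳ (+ toℕ i)) ⟨
    extend (+ toℕ i + 0ℤ * + M)   ≡⟨ extend-+-* i 0ℤ ⟩
    ℓ i + 0ℤ                      ≡⟨ ℤP.+-identityʳ (ℓ i) ⟩
    ℓ i                           ∎
    where open ≡-Reasoning

module CyclicLift {m n : ℕ} (g : Fin (suc m) → Fin (suc n)) (g-emb : IsCycEmb g) where
  private
    N = suc n
    g₀ = toℕ (g Fin.zero)

  lift : Fin (suc m) → ℤ
  lift i with g₀ ℕ.≤? toℕ (g i)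
  ... | yes _ = + toℕ (g i)
  ... | no  _ = + toℕ (g i) + + N

  lift-≥ : ∀ {i} → g₀ ℕ.≤ toℕ (g i) → lift i ≡ + toℕ (g i)
  lift-≥ {i} g₀≤gi with g₀ ℕ.≤? toℕ (g i)
  ... | yes _   = refl
  ... | no g₀≰gi = ⊥-elim (g₀≰gi g₀≤gi)

  lift-< : ∀ {i} → toℕ (g i) ℕ.< g₀ → lift i ≡ + toℕ (g i) + + N
  lift-< {i} gi<g₀ with g₀ ℕ.≤? toℕ (g i)
  ... | yes g₀≤gi = ⊥-elim (ℕP.<⇒≱ gi<g₀ g₀≤gi)
  ... | no _      = refl

  reduce-lift : ∀ i → reduce (lift i) ≡ g i
  reduce-lift i with g₀ ℕ.≤? toℕ (g i)
  ... | yes _ = reduce-toℕ (g i)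
  ... | no  _ = trans (cong reduce (cong (λ t → + toℕ (g i) + t) (sym (ℤP.*-identityˡ (+ N)))))
                      (trans (reduce-+-* (+ toℕ (g i)) 1ℤ) (reduce-toℕ (g i)))

  lift-window : ∀ i → + g₀ ℤ.≤ lift i × lift i ℤ.< + g₀ + + N
  lift-window i with g₀ ℕ.≤? toℕ (g i)
  ... | yes g₀≤gi = ℤ.+≤+ g₀≤gi , ℤ.+<+ (ℕP.<-≤-trans (FP.toℕ<n (g i)) (ℕP.m≤n+m N g₀))
  ... | no  g₀≰gi = ℤ.+≤+ (ℕP.≤-trans (ℕP.<⇒≤ (FP.toℕ<n (g Fin.zero))) (ℕP.m≤n+m N (toℕ (g i)))) ,
                    ℤ.+<+ (ℕP.+-monoˡ-< N (ℕP.≰⇒> g₀≰gi))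

  lift-zero : lift Fin.zero ≡ + g₀
  lift-zero = lift-≥ ℕP.≤-refl

  lift-strict : lift Preserves Fin._<_ ⟶ ℤ._<_
  lift-strict {Fin.zero} {j} 0<j =
    ℤP.≤∧≢⇒< (subst (ℤ._≤ lift j) (sym lift-zero) (proj₁ (lift-window j))) lift₀≢liftⱼ
    where
      lift₀≢liftⱼ : lift Fin.zero ≢ lift j
      lift₀≢liftⱼ e = ℕP.<-irrefl (cong toℕ (IsCycEmb.injective g-emb Fin.zero j
        (trans (sym (reduce-lift Fin.zero)) (trans (cong reduce e) (reduce-lift j))))) 0<j
  lift-strict {i@(Fin.suc _)} {j} i<j with IsCycEmb.preservesR g-emb Fin.zero i j (inj₁ (ℕ.z<s , i<j))
  ... | inj₁ (g₀<gi , gi<gj) =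
    subst₂ ℤ._<_ (sym (lift-≥ (ℕP.<⇒≤ g₀<gi))) (sym (lift-≥ (ℕP.<⇒≤ (ℕP.<-trans g₀<gi gi<gj)))) (ℤ.+<+ gi<gj)
  ... | inj₂ (inj₁ (gi<gj , gj<g₀)) =
    subst₂ ℤ._<_ (sym (lift-< (ℕP.<-trans gi<gj gj<g₀))) (sym (lift-< gj<g₀)) (ℤ.+<+ (ℕP.+-monoˡ-< N gi<gj))
  ... | inj₂ (inj₂ (gj<g₀ , g₀<gi)) =
    subst₂ ℤ._<_ (sym (lift-≥ (ℕP.<⇒≤ g₀<gi))) (sym (lift-< gj<g₀))
      (ℤ.+<+ (ℕP.<-≤-trans (FP.toℕ<n (g i)) (ℕP.m≤n+m N (toℕ (g j)))))

Pmap-surjective : ∀ {m n} (g : CHom (suc m) (suc n)) → ∃ λ (f : PHom (suc m) (suc n)) → ∀ i → Pmap f i ≡ cfun g i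
Pmap-surjective {n = n} (g , g-emb) = extension , λ i → trans (cong reduce (extension-on-domain i)) (reduce-lift i)
  where
    open CyclicLift g g-emb
    lift<lift₀+n : ∀ i → lift i ℤ.< lift Fin.zero + + suc n
    lift<lift₀+n i = subst (lift i ℤ.<_) (cong (_+ + suc n) (sym lift-zero)) (proj₂ (lift-window i))
    open PeriodicExtension lift lift-strict lift<lift₀+n

nerve-surjective : ∀ a bs (c : CChain a bs) → ∃ λ (p : PChain a bs) → LiesOver a bs p c
nerve-surjective a []       _       = tt , tt
nerve-surjective a (b ∷ bs) (g , c) with Pmap-surjective g | nerve-surjective b bs c
... | f , f↦g | p , p↦c = (f , p) , (f↦g , p↦c)

nerve-fibres : ∀ a bs (p p′ : PChain a bs) → SameImage a bs p p′ ⇔ ChainOrbit a bs p p′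
nerve-fibres a []       _       _         = ⇔-id _
nerve-fibres a (b ∷ bs) (f , p) (f′ , p′) = Pmap-fibres f f′ ×-⇔ nerve-fibres b bs p p′

lemma2p9 :
    -- P is well defined on morphisms (P f is an embedding [m-1] → [n-1])
    (∀ (m n : ℕ) (f : PHom (suc m) (suc n)) → IsCycEmb (Pmap f))
    -- Hom((1/m)ℤ,(1/n)ℤ) → Hom([m-1],[n-1]) is surjective
    × (∀ (m n : ℕ) (g : CHom (suc m) (suc n)) → ∃ λ (f : PHom (suc m) (suc n)) → ∀ i → Pmap f i ≡ cfun g i)
    -- same image iff they differ by the ℤ-action
    × (∀ (m n : ℕ) (f f' : PHom (suc m) (suc n)) → (∀ i → Pmap f i ≡ Pmap f' i) ⇔ SameOrbit f f')
    -- nerve: N(P) is levelwise surjective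
    × (∀ (a : ℕ) (bs : List ℕ) (c : CChain a bs) → ∃ λ (p : PChain a bs) → LiesOver a bs p c)
    -- nerve: fibres of N(P) are exactly the orbits of the induced ℤ^k-action
    × (∀ (a : ℕ) (bs : List ℕ) (p p' : PChain a bs) → SameImage a bs p p' ⇔ ChainOrbit a bs p p')
lemma2p9 =
    (λ _ _ → Pmap-IsCycEmb)
  , (λ _ _ → Pmap-surjective)
  , (λ _ _ → Pmap-fibres)
  , nerve-surjective
  , nerve-fibres
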